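{- Let $\varphi$ be the bidimensional square morphism of size $3$ over $\{0,1\}$ given, with $\varphi(c)_{(x,y)}$ the letter at column $x$ and row $y$ ($x,y\in\{0,1,2\}$), by $\varphi(0)$: row $y=0$ is $(0,0,1)$, row $y=1$ is $(0,0,0)$, row $y=2$ is $(1,1,0)$; $\varphi(1)$: row $y=0$ is $(1,1,0)$, row $y=1$ is $(0,1,0)$, row $y=2$ is $(1,1,1)$ (each row listed as $x=0,1,2$). Let $w=\varphi^\omega(1)$. Then $w$ is not recurrent along the direction $(1,3)$, i.e. the one-dimensional word $(w(\ell,3\ell))_{\ell\in\mathbb{N}}$ is not recurrent.
   Context: $\mathbb{N}=\{0,1,\ldots\}$. Iterates of a bidimensional square morphism of size $s$: $\varphi^n(c)(\mathbf{i})=\varphi(\varphi^{n-1}(c)(\mathbf{q}'))(\mathbf{r})$ with $\mathbf{i}=s\mathbf{q}'+\mathbf{r}$ componentwise, $\mathbf{r}\in\{0,\ldots,s-1\}^2$. Since $\varphi(1)_{(0,0)}=1$, $\varphi$ is prolongable on $1$ and $\varphi^\omega(1)\colon\mathbb{N}^2\to\{0,1\}$ is the limit of $\varphi^n(1)$. A one-dimensional word is recurrent if each of its prefixes occurs in it at least twice. -}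

module Defs where

open import Data.Bool using (Bool; true; false)
open import Data.Nat using (ℕ; zero; suc; _+_; _*_; _<_; _≤_)
open import Data.Nat.DivMod using (_/_; _mod_)
open import Data.Fin using (Fin; zero; suc)
open import Data.Product using (Σ; _×_)
open import Relation.Binary.PropositionalEquality using (_≡_)

-- Letters: 0 = false, 1 = true.
-- Bidimensional 2D word: ℕ → ℕ → Bool, first argument = column x, second = row y.

-- φ c x y : letter of φ(c) at column x, row y.
φ : Bool → Fin 3 → Fin 3 → Bool
φ false zero             zero             = false
φ false (suc zero)       zero             = false
φ false (suc (suc zero)) zero             = true
φ false zero             (suc zero)       = false
φ false (suc zero)       (suc zero)       = false
φ false (suc (suc zero)) (suc zero)       = false
φ false zero             (suc (suc zero)) = true
φ false (suc zero)       (suc (suc zero)) = true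
φ false (suc (suc zero)) (suc (suc zero)) = false
φ true  zero             zero             = true
φ true  (suc zero)       zero             = true
φ true  (suc (suc zero)) zero             = false
φ true  zero             (suc zero)       = false
φ true  (suc zero)       (suc zero)       = true
φ true  (suc (suc zero)) (suc zero)       = false
φ true  zero             (suc (suc zero)) = true
φ true  (suc zero)       (suc (suc zero)) = true
φ true  (suc (suc zero)) (suc (suc zero)) = true

-- n-th iterate φ^n(c), a 3^n × 3^n word (only its values on [0,3^n)² are meaningful):
-- φ^n(c)(i) = φ(φ^(n-1)(c)(q))(r) with i = 3q + r componentwise.
φ^ : ℕ → Bool → ℕ → ℕ → Bool
φ^ zero    c x y = c
φ^ (suc n) c x y = φ (φ^ n c (x / 3) (y / 3)) (x mod 3) (y mod 3)

-- The fixed point φ^ω(1): the limit of φ^n(1). Since φ is prolongable on 1,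
-- φ^n(1)(x,y) is stable for all n with x,y < 3^n; n = x + y + 1 suffices.
φω1 : ℕ → ℕ → Bool
φω1 x y = φ^ (suc (x + y)) true x y

Recurrent : (ℕ → Bool) → Set
Recurrent u = (n : ℕ) → Σ ℕ λ p → (1 ≤ p) × ((k : ℕ) → k < n → u (p + k) ≡ u k)

diag13 : (ℕ → ℕ → Bool) → ℕ → Bool
diag13 w ℓ = w ℓ (3 * ℓ)

-- Write x = 3q + s with s a digit. Then the cell (x, 3x + j) of φ^(k+1)(1) is the cell (s, j)
-- of φ applied to the cell (q, 3q + s) of φ^k(1), so the three lines y = 3x + j of the fixed
-- point determine each other. Reading off the rows of φ: the line y = 3x + 1 is constantly 0,
-- the line y = 3x + 2 is constantly 1, and hence the line y = 3x is 0 everywhere except at the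
-- origin, where it is 1. So the prefix 1 of the word along (1,3) never occurs again.
module Submission where

open import Data.Bool using (Bool; true; false; not)
open import Data.Fin using (Fin; zero; suc; toℕ)
open import Data.Fin.Properties using (toℕ<n; toℕ-fromℕ<; toℕ-injective)
open import Data.Nat using (ℕ; zero; suc; _+_; _*_; _≤_; _<_; z≤n; s≤s; s≤s⁻¹; z<s; NonZero; >-nonZero)
open import Data.Nat.DivMod
open import Data.Nat.Divisibility using (n∣m*n)
open import Data.Nat.Properties using (*-comm; +-identityʳ; <-≤-trans; m≤m+n)
open import Data.Product using (_,_)
open import Relation.Binary.PropositionalEquality
open import Relation.Nullary using (¬_)
open import Defs

open ≡-Reasoning

module _ {n : ℕ} .{{_ : NonZero n}} where

  [r+qn]/n≡q : ∀ (r : Fin n) q → (toℕ r + q * n) / n ≡ q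
  [r+qn]/n≡q r q = begin
    (toℕ r + q * n) / n    ≡⟨ +-distrib-/-∣ʳ (toℕ r) (n∣m*n q) ⟩
    toℕ r / n + q * n / n  ≡⟨ cong₂ _+_ (m<n⇒m/n≡0 (toℕ<n r)) (m*n/n≡m q n) ⟩
    q                      ∎

  [r+qn]mod[n]≡r : ∀ (r : Fin n) q → (toℕ r + q * n) mod n ≡ r
  [r+qn]mod[n]≡r r q = toℕ-injective (begin
    toℕ ((toℕ r + q * n) mod n)  ≡⟨ toℕ-fromℕ< _ ⟩
    (toℕ r + q * n) % n          ≡⟨ [m+kn]%n≡m%n (toℕ r) q n ⟩
    toℕ r % n                    ≡⟨ m<n⇒m%n≡m (toℕ<n r) ⟩
    toℕ r                        ∎)

  q<r+qn : 1 < n → ∀ (r : Fin n) q → 1 ≤ toℕ r + q * n → q < toℕ r + q * n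
  q<r+qn 1<n r q pos = subst (_< toℕ r + q * n) ([r+qn]/n≡q r q)
    (m/n<m (toℕ r + q * n) n {{>-nonZero pos}} 1<n)

quotient-< : ∀ {k} (s : Fin 3) q → 1 ≤ toℕ s + q * 3 → toℕ s + q * 3 < suc k → q < k
quotient-< s q pos x<1+k = <-≤-trans (q<r+qn (s≤s (s≤s z≤n)) s q pos) (s≤s⁻¹ x<1+k)

φ-0-0 : ∀ c → φ c zero zero ≡ c
φ-0-0 false = refl
φ-0-0 true  = refl

φ-1-0 : ∀ c → φ c (suc zero) zero ≡ c
φ-1-0 false = refl
φ-1-0 true  = refl

φ-2-0 : ∀ c → φ c (suc (suc zero)) zero ≡ not c
φ-2-0 false = refl
φ-2-0 true  = refl

φ-0-1 : ∀ c → φ c zero (suc zero) ≡ false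
φ-0-1 false = refl
φ-0-1 true  = refl

φ-1-1 : ∀ c → φ c (suc zero) (suc zero) ≡ c
φ-1-1 false = refl
φ-1-1 true  = refl

φ-2-1 : ∀ c → φ c (suc (suc zero)) (suc zero) ≡ false
φ-2-1 false = refl
φ-2-1 true  = refl

φ-0-2 : ∀ c → φ c zero (suc (suc zero)) ≡ true
φ-0-2 false = refl
φ-0-2 true  = refl

φ-1-2 : ∀ c → φ c (suc zero) (suc (suc zero)) ≡ true
φ-1-2 false = refl
φ-1-2 true  = refl

φ-2-2 : ∀ c → φ c (suc (suc zero)) (suc (suc zero)) ≡ c
φ-2-2 false = refl
φ-2-2 true  = refl

line : Fin 3 → ℕ → ℕ → Bool
line j k x = φ^ k true x (toℕ j + x * 3)

line-step : ∀ j k (s : Fin 3) q → line j (suc k) (toℕ s + q * 3) ≡ φ (line s k q) s j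
line-step j k s q
  rewrite [r+qn]/n≡q j (toℕ s + q * 3) | [r+qn]mod[n]≡r j (toℕ s + q * 3)
        | [r+qn]/n≡q s q | [r+qn]mod[n]≡r s q = refl

line1≡false : ∀ k x → x < k → line (suc zero) k x ≡ false
line1≡false (suc k) x x<1+k with x divMod 3
... | result q zero refl = trans (line-step _ k zero q) (φ-0-1 _)
... | result q (suc zero) refl = begin
  line (suc zero) (suc k) (1 + q * 3)            ≡⟨ line-step _ k (suc zero) q ⟩
  φ (line (suc zero) k q) (suc zero) (suc zero)  ≡⟨ φ-1-1 _ ⟩
  line (suc zero) k q                            ≡⟨ line1≡false k q (quotient-< (suc zero) q (s≤s z≤n) x<1+k) ⟩
  false                                          ∎
... | result q (suc (suc zero)) refl = trans (line-step _ k (suc (suc zero)) q) (φ-2-1 _)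

line2≡true : ∀ k x → x < k → line (suc (suc zero)) k x ≡ true
line2≡true (suc k) x x<1+k with x divMod 3
... | result q zero refl = trans (line-step _ k zero q) (φ-0-2 _)
... | result q (suc zero) refl = trans (line-step _ k (suc zero) q) (φ-1-2 _)
... | result q (suc (suc zero)) refl = begin
  line (suc (suc zero)) (suc k) (2 + q * 3)                        ≡⟨ line-step _ k (suc (suc zero)) q ⟩
  φ (line (suc (suc zero)) k q) (suc (suc zero)) (suc (suc zero))  ≡⟨ φ-2-2 _ ⟩
  line (suc (suc zero)) k q                                        ≡⟨ line2≡true k q (quotient-< (suc (suc zero)) q (s≤s z≤n) x<1+k) ⟩
  true                                                             ∎

line0≡false : ∀ k x → 1 ≤ x → x < k → line zero k x ≡ false
line0≡false (suc k) x 1≤x x<1+k with x divMod 3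
line0≡false (suc k) _ () _ | result zero zero refl
... | result (suc q) zero refl = begin
  line zero (suc k) (suc q * 3)       ≡⟨ line-step _ k zero (suc q) ⟩
  φ (line zero k (suc q)) zero zero   ≡⟨ φ-0-0 _ ⟩
  line zero k (suc q)                 ≡⟨ line0≡false k (suc q) (s≤s z≤n) (quotient-< zero (suc q) 1≤x x<1+k) ⟩
  false                               ∎
... | result q (suc zero) refl = begin
  line zero (suc k) (1 + q * 3)                 ≡⟨ line-step _ k (suc zero) q ⟩
  φ (line (suc zero) k q) (suc zero) zero       ≡⟨ φ-1-0 _ ⟩
  line (suc zero) k q                           ≡⟨ line1≡false k q (quotient-< (suc zero) q (s≤s z≤n) x<1+k) ⟩
  false                                         ∎
... | result q (suc (suc zero)) refl = begin
  line zero (suc k) (2 + q * 3)                          ≡⟨ line-step _ k (suc (suc zero)) q ⟩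
  φ (line (suc (suc zero)) k q) (suc (suc zero)) zero    ≡⟨ φ-2-0 _ ⟩
  not (line (suc (suc zero)) k q)                        ≡⟨ cong not (line2≡true k q (quotient-< (suc (suc zero)) q (s≤s z≤n) x<1+k)) ⟩
  false                                                  ∎

diag13-φω1≡false : ∀ p → 1 ≤ p → diag13 φω1 p ≡ false
diag13-φω1≡false p 1≤p = begin
  diag13 φω1 p                   ≡⟨ cong (φ^ (suc (p + 3 * p)) true p) (*-comm 3 p) ⟩
  line zero (suc (p + 3 * p)) p  ≡⟨ line0≡false _ p 1≤p (s≤s (m≤m+n p _)) ⟩
  false                          ∎

proposition6p19 : ¬ Recurrent (diag13 φω1)
proposition6p19 recurrent with recurrent 1
... | p , 1≤p , prefix-recurs = false≢true (begin
  false               ≡⟨ diag13-φω1≡false p 1≤p ⟨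
  diag13 φω1 p        ≡⟨ cong (diag13 φω1) (+-identityʳ p) ⟨
  diag13 φω1 (p + 0)  ≡⟨ prefix-recurs 0 z<s ⟩
  diag13 φω1 0        ≡⟨⟩
  true                ∎)
  where
  false≢true : false ≢ true
  false≢true ()
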